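{- Let $G$ be a finite simple graph and let $K_{s_1},K_{s_2},\ldots,K_{s_k}$ be pairwise edge-disjoint cliques of $G$ with $s_i\ge3$ for all $i$. Then the independence number of the triangular signed graph of $G$ satisfies $$\alpha(G_{\vartriangle})\ge\sum_{i=1}^k\frac{\binom{s_i}3}{1+3(s_i-3)}.$$
   Context: The triangular signed graph $G_{\vartriangle}$ of a graph $G$ has the triangles of $G$ as vertices, two distinct triangles being adjacent (with some sign, depending on chosen orientations) exactly when they share an edge of $G$. The independence number $\alpha$ refers to the underlying unsigned graph of $G_{\vartriangle}$. -}

module Defs where

open import Data.Nat using (ℕ; zero; suc; _∸_; _*_) renaming (_+_ to _+ℕ_)
open import Data.Nat.Combinatorics using (_C_)
open import Data.Fin using (Fin; zero; suc) renaming (_<_ to _<F_)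
open import Data.Integer using (+_)
open import Data.Rational using (ℚ; 0ℚ; _/_; _+_)
open import Data.Product using (Σ; _×_; ∃-syntax)
open import Data.Sum using (_⊎_)
open import Data.List using (List)
open import Relation.Binary.PropositionalEquality using (_≡_; _≢_)
open import Relation.Nullary using (¬_; Dec)

record Graph (n : ℕ) : Set₁ where
  field
    Adj   : Fin n → Fin n → Set
    adj?  : ∀ u v → Dec (Adj u v)
    sym   : ∀ {u v} → Adj u v → Adj v u
    irrefl : ∀ {u} → ¬ Adj u u
open Graph public

-- Candidate triangles are vertex triples; a triple (a , b , c) is a triangle
-- of G when a < b < c and all three pairs are adjacent (so every triangle
-- has exactly one representation).
Triple : ℕ → Set
Triple n = Fin n × Fin n × Fin n

IsTriangle : ∀ {n} → Graph n → Triple n → Set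
IsTriangle G (a Data.Product., b Data.Product., c) =
  (a <F b) × (b <F c) × Adj G a b × Adj G b c × Adj G a c

_∈T_ : ∀ {n} → Fin n → Triple n → Set
u ∈T (a Data.Product., b Data.Product., c) = (u ≡ a) ⊎ (u ≡ b) ⊎ (u ≡ c)

-- two triangles share an edge (have two distinct common vertices);
-- for distinct triangles this is adjacency in the triangular graph G_△.
ShareEdge : ∀ {n} → Triple n → Triple n → Set
ShareEdge {n} t t' = ∃[ u ] ∃[ v ] (u ≢ v × u ∈T t × v ∈T t × u ∈T t' × v ∈T t')

sumFin : (k : ℕ) → (Fin k → ℚ) → ℚ
sumFin zero f = 0ℚ
sumFin (suc k) f = f zero + sumFin k (λ i → f (suc i))

term : ℕ → ℚ
term s = (+ (s C 3)) / suc (3 * (s ∸ 3))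

{-# OPTIONS --safe #-}
module Submission where

open import Defs
open import Data.Nat using (ℕ; _≤_)
open import Data.Fin using (Fin)
open import Data.Integer using (+_)
open import Data.Rational using (ℚ; _/_) renaming (_≤_ to _≤ℚ_)
open import Data.Product using (Σ; _×_; ∃-syntax)
open import Data.List using (List; length)
open import Data.List.Membership.Propositional using (_∈_)
open import Data.List.Relation.Unary.All using (All)
open import Data.List.Relation.Unary.AllPairs using (AllPairs)
open import Data.List.Relation.Unary.Unique.Propositional using (Unique)
open import Relation.Binary.PropositionalEquality using (_≢_)
open import Relation.Nullary using (¬_)
open import Data.Empty using (⊥)

open import Data.Empty using (⊥-elim)
open import Data.Fin using (zero; suc; toℕ; fromℕ<; inject≤; _↑ʳ_; splitAt; join; remQuot; combine)
  renaming (_<_ to _<F_)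
open import Data.Fin.Properties
  using (toℕ-injective; toℕ-fromℕ<; toℕ≤pred[n]; splitAt-↑ˡ; splitAt-↑ʳ; splitAt-join;
         combine-remQuot; inject≤-injective; <-cmp; suc-injective)
open import Data.Integer using (+≤+)
import Data.Integer as ℤ
import Data.Integer.Properties as ℤ
import Data.Integer.Tactic.RingSolver as ℤ-Solver
open import Data.List using ([]; _++_; lookup; tabulate)
open import Data.List.Membership.Propositional.Properties using (∈-lookup)
open import Data.List.Properties using (length-++; length-tabulate)
import Data.List.Relation.Unary.All as All
import Data.List.Relation.Unary.All.Properties as All
open import Data.List.Relation.Unary.AllPairs using ([]; _∷_)
import Data.List.Relation.Unary.AllPairs.Properties as AllPairs
open import Data.Nat using (zero; suc; _+_; _*_; s≤s)
import Data.Nat.Properties as ℕ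
open import Data.Nat.Combinatorics using (_C_; _P_; nCk≡nPk/k!)
open import Data.Nat.DivMod using (m*n/n≡m; /-monoˡ-≤) renaming (_/_ to _div_)
open import Data.Nat.Tactic.RingSolver using (solve-∀)
open import Data.Product using (Σ-syntax; _,_; proj₁; proj₂; uncurry)
import Data.Rational as ℚ
import Data.Rational.Properties as ℚ
import Data.Rational.Unnormalised as ℚᵘ
import Data.Rational.Unnormalised.Properties as ℚᵘ
open import Data.Sum using (_⊎_; inj₁; inj₂; [_,_]; map₂)
open import Function using (_∘_)
open import Relation.Binary.Definitions using (Symmetric; tri<; tri≈; tri>)
open import Relation.Binary.PropositionalEquality using (_≡_; refl; cong; trans; subst; subst₂)
import Relation.Binary.PropositionalEquality as ≡

-- Inside a clique K_s take three disjoint blocks of vertices, of sizes p, q and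
-- p + q - 1, and for i < p, j < q the triangle on the i-th vertex of the first
-- block, the j-th of the second and the (i + j)-th of the third.  Any two of
-- i, j, i + j determine (i , j), so these p q triangles pairwise share no edge,
-- and choosing p, q ≈ s / 4 according to s mod 4 gives
-- p q ≥ binom(s,3) / (1 + 3 (s - 3)).  Triangles chosen in different cliques
-- share no edge because the cliques are edge-disjoint.

remQuot-injective : ∀ {m} n {k l : Fin (m * n)} → remQuot {m} n k ≡ remQuot n l → k ≡ l
remQuot-injective {m} n {k} {l} eq = begin
  k                                     ≡⟨ combine-remQuot {m} n k ⟨
  uncurry combine (remQuot {m} n k)     ≡⟨ cong (uncurry (combine {m})) eq ⟩
  uncurry combine (remQuot {m} n l)     ≡⟨ combine-remQuot {m} n l ⟩
  l                                     ∎
  where open ≡.≡-Reasoning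

lookup-injective : ∀ {A : Set} {xs : List A} → Unique xs → ∀ {i j} → lookup xs i ≡ lookup xs j → i ≡ j
lookup-injective (_    ∷ _)      {zero}  {zero}  _  = refl
lookup-injective (x∉xs ∷ _)      {zero}  {suc j} eq = ⊥-elim (All.lookup x∉xs (∈-lookup j) eq)
lookup-injective (x∉xs ∷ _)      {suc i} {zero}  eq = ⊥-elim (All.lookup x∉xs (∈-lookup i) (≡.sym eq))
lookup-injective (_    ∷ unique) {suc i} {suc j} eq = cong suc (lookup-injective unique eq)

AllPairs-lookup : ∀ {A : Set} {R : A → A → Set} {xs : List A} → Symmetric R → AllPairs R xs →
                  ∀ {i j} → i ≢ j → R (lookup xs i) (lookup xs j)
AllPairs-lookup R-sym (_  ∷ _)  {zero}  {zero}  i≢j = ⊥-elim (i≢j refl)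
AllPairs-lookup R-sym (Rx ∷ _)  {zero}  {suc j} _   = All.lookup Rx (∈-lookup j)
AllPairs-lookup R-sym (Rx ∷ _)  {suc i} {zero}  _   = R-sym (All.lookup Rx (∈-lookup i))
AllPairs-lookup R-sym (_  ∷ Rs) {suc i} {suc j} i≢j = AllPairs-lookup R-sym Rs (i≢j ∘ cong suc)

-- `(+ a) / suc d` computes to `fromℚᵘ (mkℚᵘ (+ a) d)`, so the next two facts are proved in ℚᵘ.
/1-homo-+ : ∀ a b → (+ a) / 1 ℚ.+ (+ b) / 1 ≡ (+ (a + b)) / 1
/1-homo-+ a b = ℚ.toℚᵘ-injective (begin
  ℚ.toℚᵘ ((+ a) / 1 ℚ.+ (+ b) / 1)
    ≈⟨ ℚ.toℚᵘ-homo-+ ((+ a) / 1) ((+ b) / 1) ⟩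
  ℚ.toℚᵘ ((+ a) / 1) ℚᵘ.+ ℚ.toℚᵘ ((+ b) / 1)
    ≈⟨ ℚᵘ.+-cong (ℚ.toℚᵘ-fromℚᵘ (ℚᵘ.mkℚᵘ (+ a) 0)) (ℚ.toℚᵘ-fromℚᵘ (ℚᵘ.mkℚᵘ (+ b) 0)) ⟩
  ℚᵘ.mkℚᵘ (+ a) 0 ℚᵘ.+ ℚᵘ.mkℚᵘ (+ b) 0
    ≈⟨ ℚᵘ.*≡* (trans (cross-multiplied (+ a) (+ b)) (cong (ℤ._* + 1) (≡.sym (ℤ.pos-+ a b)))) ⟩
  ℚᵘ.mkℚᵘ (+ (a + b)) 0
    ≈⟨ ℚ.toℚᵘ-fromℚᵘ (ℚᵘ.mkℚᵘ (+ (a + b)) 0) ⟨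
  ℚ.toℚᵘ ((+ (a + b)) / 1) ∎)
  where
  open ℚᵘ.≃-Reasoning
  cross-multiplied : ∀ x y → (x ℤ.* + 1 ℤ.+ y ℤ.* + 1) ℤ.* + 1 ≡ (x ℤ.+ y) ℤ.* + 1
  cross-multiplied = ℤ-Solver.solve-∀

≤*⇒/≤/1 : ∀ {a b d} → a ≤ b * suc d → (+ a) / suc d ≤ℚ (+ b) / 1
≤*⇒/≤/1 {a} {b} {d} a≤b*d = ℚ.toℚᵘ-cancel-≤ (begin
  ℚ.toℚᵘ ((+ a) / suc d)  ≃⟨ ℚ.toℚᵘ-fromℚᵘ (ℚᵘ.mkℚᵘ (+ a) d) ⟩
  ℚᵘ.mkℚᵘ (+ a) d        ≤⟨ ℚᵘ.*≤* cross-multiplied ⟩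
  ℚᵘ.mkℚᵘ (+ b) 0        ≃⟨ ℚ.toℚᵘ-fromℚᵘ (ℚᵘ.mkℚᵘ (+ b) 0) ⟨
  ℚ.toℚᵘ ((+ b) / 1)     ∎)
  where
  open ℚᵘ.≤-Reasoning
  cross-multiplied : + a ℤ.* + 1 ℤ.≤ + b ℤ.* + suc d
  cross-multiplied = subst₂ ℤ._≤_ (ℤ.pos-* a 1) (ℤ.pos-* b (suc d))
    (+≤+ (subst (_≤ b * suc d) (≡.sym (ℕ.*-identityʳ a)) a≤b*d))

P3≤6*⇒C3≤ : ∀ {s N} → 3 ≤ s → s P 3 ≤ 6 * N → s C 3 ≤ N
P3≤6*⇒C3≤ {s} {N} 3≤s sP3≤6N = begin
  s C 3           ≡⟨ nCk≡nPk/k! 3≤s ⟩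
  (s P 3) div 6   ≤⟨ /-monoˡ-≤ 6 (ℕ.≤-trans sP3≤6N (ℕ.≤-reflexive (ℕ.*-comm 6 N))) ⟩
  (N * 6) div 6   ≡⟨ m*n/n≡m N 6 ⟩
  N               ∎
  where open ℕ.≤-Reasoning

term-3+-≤ : ∀ m N {D} → (3 + m) P 3 + D ≡ 6 * (N * suc (3 * m)) → term (3 + m) ≤ℚ (+ N) / 1
term-3+-≤ m N {D} surplus = ≤*⇒/≤/1 {b = N} {d = 3 * m} (P3≤6*⇒C3≤ (ℕ.m≤m+n 3 m) P3≤6N)
  where
  P3≤6N : (3 + m) P 3 ≤ 6 * (N * suc (3 * m))
  P3≤6N = subst ((3 + m) P 3 ≤_) surplus (ℕ.m≤m+n _ D)

data Mod4 : ℕ → Set where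
  rem0 : ∀ t → Mod4 (4 * t)
  rem1 : ∀ t → Mod4 (1 + 4 * t)
  rem2 : ∀ t → Mod4 (2 + 4 * t)
  rem3 : ∀ t → Mod4 (3 + 4 * t)

mod4 : ∀ m → Mod4 m
mod4 zero = rem0 0
mod4 (suc m) with mod4 m
... | rem0 t = rem1 t
... | rem1 t = rem2 t
... | rem2 t = rem3 t
... | rem3 t = subst Mod4 (ℕ.*-suc 4 t) (rem0 (suc t))

Block : ℕ → ℕ → Set
Block r c = Fin (suc r) ⊎ Fin (suc c) ⊎ Fin (suc (r + c))

blockSize : ℕ → ℕ → ℕ
blockSize r c = suc r + (suc c + suc (r + c))

blockSize-t-t : ∀ t → suc t + (suc t + suc (t + t)) ≡ 3 + 4 * t
blockSize-t-t = solve-∀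

blockSize-t-1+t : ∀ t → suc t + (suc (suc t) + suc (t + suc t)) ≡ 3 + (2 + 4 * t)
blockSize-t-1+t = solve-∀

-- The grid has p = 1 + r rows and q = 1 + c columns.
record GridFor (s : ℕ) : Set where
  constructor grid
  field
    r c   : ℕ
    fits  : blockSize r c ≤ s
    beats : term s ≤ℚ (+ (suc r * suc c)) / 1

-- `(3 + m) P 3` unfolds to `(1 + m) * ((2 + m) * ((3 + m) * 1))`; each `surplus` is
-- 6 p q (1 + 3 m) minus it, a polynomial in t with nonnegative coefficients.
grid-4t+3 : ∀ t → GridFor (3 + 4 * t)
grid-4t+3 t = grid t t (ℕ.≤-reflexive (blockSize-t-t t))
  (term-3+-≤ (4 * t) (suc t * suc t) (surplus t))
  where
  surplus : ∀ t → (1 + 4 * t) * ((2 + 4 * t) * ((3 + 4 * t) * 1)) + (8 * t * t * t + 54 * t * t + 40 * t)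
                  ≡ 6 * (suc t * suc t * suc (3 * (4 * t)))
  surplus = solve-∀

grid-4t+4 : ∀ t → GridFor (3 + (1 + 4 * t))
grid-4t+4 t = grid t t (ℕ.m≤n⇒m≤1+n (ℕ.≤-reflexive (blockSize-t-t t)))
  (term-3+-≤ (1 + 4 * t) (suc t * suc t) (surplus t))
  where
  surplus : ∀ t → (2 + 4 * t) * ((3 + 4 * t) * ((4 + 4 * t) * 1)) + (8 * t * t * t + 24 * t * t + 16 * t)
                  ≡ 6 * (suc t * suc t * suc (3 * (1 + 4 * t)))
  surplus = solve-∀

grid-4t+5 : ∀ t → GridFor (3 + (2 + 4 * t))
grid-4t+5 t = grid t (suc t) (ℕ.≤-reflexive (blockSize-t-1+t t))
  (term-3+-≤ (2 + 4 * t) (suc t * suc (suc t)) (surplus t))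
  where
  surplus : ∀ t → (3 + 4 * t) * ((4 + 4 * t) * ((5 + 4 * t) * 1)) + (8 * t * t * t + 66 * t * t + 82 * t + 24)
                  ≡ 6 * (suc t * suc (suc t) * suc (3 * (2 + 4 * t)))
  surplus = solve-∀

grid-4t+6 : ∀ t → GridFor (3 + (3 + 4 * t))
grid-4t+6 t = grid t (suc t) (ℕ.m≤n⇒m≤1+n (ℕ.≤-reflexive (blockSize-t-1+t t)))
  (term-3+-≤ (3 + 4 * t) (suc t * suc (suc t)) (surplus t))
  where
  surplus : ∀ t → (4 + 4 * t) * ((5 + 4 * t) * ((6 + 4 * t) * 1)) + (8 * t * t * t + 36 * t * t + 28 * t)
                  ≡ 6 * (suc t * suc (suc t) * suc (3 * (3 + 4 * t)))
  surplus = solve-∀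

gridFor : ∀ s → 3 ≤ s → GridFor s
gridFor (suc (suc (suc m))) _ with mod4 m
... | rem0 t = grid-4t+3 t
... | rem1 t = grid-4t+4 t
... | rem2 t = grid-4t+5 t
... | rem3 t = grid-4t+6 t
gridFor 1 (s≤s ())
gridFor 2 (s≤s (s≤s ()))

Point : ℕ → ℕ → Set
Point r c = Fin (suc r) × Fin (suc c)

diagonal : ∀ {r c} → Fin (suc r) → Fin (suc c) → Fin (suc (r + c))
diagonal i j = fromℕ< (s≤s (ℕ.+-mono-≤ (toℕ≤pred[n] i) (toℕ≤pred[n] j)))

infix 4 _∈▵_
data _∈▵_ {r c : ℕ} : Block r c → Point r c → Set where
  row  : ∀ {i j} → inj₁ i ∈▵ (i , j)
  col  : ∀ {i j} → inj₂ (inj₁ j) ∈▵ (i , j)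
  diag : ∀ {i j k} → toℕ k ≡ toℕ i + toℕ j → inj₂ (inj₂ k) ∈▵ (i , j)

diag-cancelˡ : ∀ {m m' m''} {i : Fin m} {j j' : Fin m'} {k : Fin m''} →
               toℕ k ≡ toℕ i + toℕ j → toℕ k ≡ toℕ i + toℕ j' → j ≡ j'
diag-cancelˡ {i = i} p q = toℕ-injective (ℕ.+-cancelˡ-≡ (toℕ i) _ _ (trans (≡.sym p) q))

diag-cancelʳ : ∀ {m m' m''} {i i' : Fin m} {j : Fin m'} {k : Fin m''} →
               toℕ k ≡ toℕ i + toℕ j → toℕ k ≡ toℕ i' + toℕ j → i ≡ i'
diag-cancelʳ {j = j} p q = toℕ-injective (ℕ.+-cancelʳ-≡ (toℕ j) _ _ (trans (≡.sym p) q))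

∈▵-edge-determines : ∀ {r c} {x y : Block r c} {a b : Point r c} →
                     x ≢ y → x ∈▵ a → y ∈▵ a → x ∈▵ b → y ∈▵ b → a ≡ b
∈▵-edge-determines x≢y row      row      _        _        = ⊥-elim (x≢y refl)
∈▵-edge-determines x≢y row      col      row      col      = refl
∈▵-edge-determines x≢y row      (diag p) row      (diag q) = cong (_ ,_) (diag-cancelˡ p q)
∈▵-edge-determines x≢y col      row      col      row      = refl
∈▵-edge-determines x≢y col      col      _        _        = ⊥-elim (x≢y refl)
∈▵-edge-determines x≢y col      (diag p) col      (diag q) = cong (_, _) (diag-cancelʳ p q)
∈▵-edge-determines x≢y (diag p) row      (diag q) row      = cong (_ ,_) (diag-cancelˡ p q)
∈▵-edge-determines x≢y (diag p) col      (diag q) col      = cong (_, _) (diag-cancelʳ p q)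
∈▵-edge-determines x≢y (diag p) (diag q) _        _        =
  ⊥-elim (x≢y (cong (inj₂ ∘ inj₂) (toℕ-injective (trans p (≡.sym q)))))

encode : ∀ {r c} → Block r c → Fin (blockSize r c)
encode {r} {c} = join (suc r) _ ∘ map₂ (join (suc c) (suc (r + c)))

decode : ∀ {r c} → Fin (blockSize r c) → Block r c
decode {r} {c} = map₂ (splitAt (suc c)) ∘ splitAt (suc r)

decode-encode : ∀ {r c} (x : Block r c) → decode (encode x) ≡ x
decode-encode {r} {c} (inj₁ i) = cong (map₂ (splitAt (suc c))) (splitAt-↑ˡ (suc r) i _)
decode-encode {r} {c} (inj₂ y) = begin
  map₂ (splitAt (suc c)) (splitAt (suc r) (suc r ↑ʳ join (suc c) _ y))
    ≡⟨ cong (map₂ (splitAt (suc c))) (splitAt-↑ʳ (suc r) _ _) ⟩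
  inj₂ (splitAt (suc c) (join (suc c) _ y))
    ≡⟨ cong inj₂ (splitAt-join (suc c) _ y) ⟩
  inj₂ y ∎
  where open ≡.≡-Reasoning

encode-injective : ∀ {r c} {x y : Block r c} → encode x ≡ encode y → x ≡ y
encode-injective {x = x} {y} eq =
  trans (≡.sym (decode-encode x)) (trans (cong decode eq) (decode-encode y))

ShareNoEdge : ∀ {n} → List (Fin n) → List (Fin n) → Set
ShareNoEdge A B = ∀ u v → u ≢ v → u ∈ A → v ∈ A → u ∈ B → v ∈ B → ⊥

module _ {n : ℕ} (G : Graph n) where

  Inside : (Fin n → Set) → Triple n → Set
  Inside S τ = ∀ u → u ∈T τ → S u

  record Packing (Region : Triple n → Set) : Set where
    constructor packing
    field
      triangles     : List (Triple n)
      are-triangles : All (IsTriangle G) triangles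
      edge-disjoint : AllPairs (λ τ σ → ¬ ShareEdge τ σ) triangles
      in-region     : All Region triangles

    size : ℕ
    size = length triangles

  open Packing

  map-region : ∀ {R R' : Triple n → Set} → (∀ {τ} → R τ → R' τ) → Packing R → Packing R'
  map-region f 𝒫 = packing (triangles 𝒫) (are-triangles 𝒫) (edge-disjoint 𝒫) (All.map f (in-region 𝒫))

  packing-++ : ∀ {R R' : Triple n → Set} → (∀ {τ σ} → R τ → R' σ → ¬ ShareEdge τ σ) →
               Packing R → Packing R' → Packing (λ τ → R τ ⊎ R' τ)
  packing-++ apart 𝒫 𝒬 = packing
    (triangles 𝒫 ++ triangles 𝒬)
    (All.++⁺ (are-triangles 𝒫) (are-triangles 𝒬))
    (AllPairs.++⁺ (edge-disjoint 𝒫) (edge-disjoint 𝒬)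
      (All.map (λ Rτ → All.map (apart Rτ) (in-region 𝒬)) (in-region 𝒫)))
    (All.++⁺ (All.map inj₁ (in-region 𝒫)) (All.map inj₂ (in-region 𝒬)))

  Inside-all : ∀ {S : Fin n → Set} {a b c} → S a → S b → S c → Inside S (a , b , c)
  Inside-all Sa Sb Sc _ (inj₁ refl)        = Sa
  Inside-all Sa Sb Sc _ (inj₂ (inj₁ refl)) = Sb
  Inside-all Sa Sb Sc _ (inj₂ (inj₂ refl)) = Sc

  TriangleIn : (Fin n → Set) → Set
  TriangleIn S = Σ[ τ ∈ Triple n ] IsTriangle G τ × Inside S τ

  insert-vertex : ∀ {S : Fin n → Set} {a b z} → a <F b → Adj G a b → Adj G z a → Adj G z b →
                  S a → S b → S z → TriangleIn S
  insert-vertex {a = a} {b} {z} a<b ab za zb Sa Sb Sz with <-cmp z a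
  ... | tri< z<a _ _ = (z , a , b) , (z<a , a<b , za , ab , zb) , Inside-all Sz Sa Sb
  ... | tri≈ _ refl _ = ⊥-elim (irrefl G za)
  ... | tri> _ _ a<z with <-cmp z b
  ...   | tri< z<b _ _ = (a , z , b) , (a<z , z<b , sym G za , zb , ab) , Inside-all Sa Sz Sb
  ...   | tri≈ _ refl _ = ⊥-elim (irrefl G zb)
  ...   | tri> _ _ b<z = (a , b , z) , (a<b , b<z , ab , sym G zb , sym G za) , Inside-all Sa Sb Sz

  sort-triangle : ∀ {S : Fin n → Set} {x y z} → Adj G x y → Adj G y z → Adj G x z →
                  S x → S y → S z → TriangleIn S
  sort-triangle {x = x} {y} xy yz xz Sx Sy Sz with <-cmp x y
  ... | tri< x<y _ _ = insert-vertex x<y xy (sym G xz) (sym G yz) Sx Sy Sz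
  ... | tri≈ _ refl _ = ⊥-elim (irrefl G xy)
  ... | tri> _ _ y<x = insert-vertex y<x (sym G xy) (sym G yz) (sym G xz) Sy Sx Sz

  module _ {r c : ℕ} (e : Block r c → Fin n) (e-injective : ∀ {x y} → e x ≡ e y → x ≡ y)
           (e-adjacent : ∀ {x y} → x ≢ y → Adj G (e x) (e y)) where

    CornerOf : Point r c → Fin n → Set
    CornerOf a u = ∃[ x ] x ∈▵ a × u ≡ e x

    triangleAt : (a : Point r c) → TriangleIn (CornerOf a)
    triangleAt (i , j) = sort-triangle (e-adjacent λ ()) (e-adjacent λ ()) (e-adjacent λ ())
      (inj₁ i , row , refl) (inj₂ (inj₁ j) , col , refl)
      (inj₂ (inj₂ (diagonal i j)) , diag (toℕ-fromℕ< _) , refl)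

    cornerOf : ∀ a {u} → u ∈T proj₁ (triangleAt a) → CornerOf a u
    cornerOf a = proj₂ (proj₂ (triangleAt a)) _

    shared-edge-determines : ∀ {a b} → ShareEdge (proj₁ (triangleAt a)) (proj₁ (triangleAt b)) → a ≡ b
    shared-edge-determines {a} {b} (u , v , u≢v , u∈a , v∈a , u∈b , v∈b) =
      corners u≢v (cornerOf a u∈a) (cornerOf a v∈a) (cornerOf b u∈b) (cornerOf b v∈b)
      where
      corners : ∀ {u v} → u ≢ v → CornerOf a u → CornerOf a v → CornerOf b u → CornerOf b v → a ≡ b
      corners u≢v (x , x∈a , refl) (y , y∈a , refl) (x' , x∈b , ex≡ex') (y' , y∈b , ey≡ey')
        with refl ← e-injective ex≡ex' | refl ← e-injective ey≡ey'
        = ∈▵-edge-determines (u≢v ∘ cong e) x∈a y∈a x∈b y∈b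

    grid-packing : (S : Fin n → Set) → (∀ x → S (e x)) →
                   Σ[ 𝒫 ∈ Packing (Inside S) ] size 𝒫 ≡ suc r * suc c
    grid-packing S e∈S =
      packing (tabulate triangle) all-triangles pairwise-disjoint all-inside , length-tabulate triangle
      where
      triangle : Fin (suc r * suc c) → Triple n
      triangle = proj₁ ∘ triangleAt ∘ remQuot (suc c)

      all-triangles : All (IsTriangle G) (tabulate triangle)
      all-triangles = All.tabulate⁺ (proj₁ ∘ proj₂ ∘ triangleAt ∘ remQuot (suc c))

      pairwise-disjoint : AllPairs (λ τ σ → ¬ ShareEdge τ σ) (tabulate triangle)
      pairwise-disjoint = AllPairs.tabulate⁺ λ k≢l shared →
        k≢l (remQuot-injective (suc c) (shared-edge-determines shared))

      all-inside : All (Inside S) (tabulate triangle)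
      all-inside = All.tabulate⁺ λ k u u∈τ → case-corner (cornerOf (remQuot (suc c) k) u∈τ)
        where
        case-corner : ∀ {a u} → CornerOf a u → S u
        case-corner (x , _ , refl) = e∈S x

  clique-packing : ∀ {L} → Unique L → AllPairs (Adj G) L → 3 ≤ length L →
                   Σ[ 𝒫 ∈ Packing (Inside (_∈ L)) ] term (length L) ≤ℚ (+ size 𝒫) / 1
  clique-packing {L} unique clique 3≤|L| with gridFor (length L) 3≤|L|
  ... | grid r c fits beats = 𝒫 , subst (λ N → term (length L) ≤ℚ (+ N) / 1) (≡.sym |𝒫|≡rc) beats
    where
    position : Block r c → Fin (length L)
    position x = inject≤ (encode x) fits

    position-injective : ∀ {x y} → position x ≡ position y → x ≡ y
    position-injective = encode-injective ∘ inject≤-injective fits fits _ _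

    e : Block r c → Fin n
    e = lookup L ∘ position

    packed : Σ[ 𝒫 ∈ Packing (Inside (_∈ L)) ] size 𝒫 ≡ suc r * suc c
    packed = grid-packing e (position-injective ∘ lookup-injective unique)
             (λ x≢y → AllPairs-lookup (sym G) clique (x≢y ∘ position-injective))
             (_∈ L) (∈-lookup ∘ position)

    𝒫 : Packing (Inside (_∈ L))
    𝒫 = proj₁ packed

    |𝒫|≡rc : size 𝒫 ≡ suc r * suc c
    |𝒫|≡rc = proj₂ packed

  Inside-apart : ∀ {A B τ σ} → ShareNoEdge A B → Inside (_∈ A) τ → Inside (_∈ B) σ → ¬ ShareEdge τ σ
  Inside-apart A#B τ⊆A σ⊆B (u , v , u≢v , u∈τ , v∈τ , u∈σ , v∈σ) =
    A#B u v u≢v (τ⊆A u u∈τ) (τ⊆A v v∈τ) (σ⊆B u u∈σ) (σ⊆B v v∈σ)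

  family-packing : ∀ k (K : Fin k → List (Fin n)) (w : Fin k → ℚ) →
    (∀ i j → i ≢ j → ShareNoEdge (K i) (K j)) →
    (∀ i → Σ[ 𝒫 ∈ Packing (Inside (_∈ K i)) ] w i ≤ℚ (+ size 𝒫) / 1) →
    Σ[ 𝒫 ∈ Packing (λ τ → ∃[ i ] Inside (_∈ K i) τ) ] sumFin k w ≤ℚ (+ size 𝒫) / 1
  family-packing zero    K w apart packings = packing [] All.[] [] All.[] , ℚ.≤-refl
  family-packing (suc k) K w apart packings =
    map-region [ (zero ,_) , (λ (j , σ⊆K) → suc j , σ⊆K) ] (packing-++ first-apart 𝒫₀ 𝒫₊) , bound
    where
    𝒫₀ : Packing (Inside (_∈ K zero))
    𝒫₀ = proj₁ (packings zero)

    rest : Σ[ 𝒫 ∈ Packing (λ τ → ∃[ j ] Inside (_∈ K (suc j)) τ) ]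
             sumFin k (w ∘ suc) ≤ℚ (+ size 𝒫) / 1
    rest = family-packing k (K ∘ suc) (w ∘ suc)
             (λ i j i≢j → apart (suc i) (suc j) (i≢j ∘ suc-injective)) (packings ∘ suc)

    𝒫₊ : Packing (λ τ → ∃[ j ] Inside (_∈ K (suc j)) τ)
    𝒫₊ = proj₁ rest

    first-apart : ∀ {τ σ} → Inside (_∈ K zero) τ → ∃[ j ] Inside (_∈ K (suc j)) σ → ¬ ShareEdge τ σ
    first-apart τ⊆K (j , σ⊆K) = Inside-apart (apart zero (suc j) λ ()) τ⊆K σ⊆K

    bound : sumFin (suc k) w ≤ℚ (+ length (triangles 𝒫₀ ++ triangles 𝒫₊)) / 1
    bound = begin
      w zero ℚ.+ sumFin k (w ∘ suc)
        ≤⟨ ℚ.+-mono-≤ (proj₂ (packings zero)) (proj₂ rest) ⟩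
      (+ size 𝒫₀) / 1 ℚ.+ (+ size 𝒫₊) / 1
        ≡⟨ /1-homo-+ (size 𝒫₀) (size 𝒫₊) ⟩
      (+ (size 𝒫₀ + size 𝒫₊)) / 1
        ≡⟨ cong (λ N → (+ N) / 1) (length-++ (triangles 𝒫₀)) ⟨
      (+ length (triangles 𝒫₀ ++ triangles 𝒫₊)) / 1 ∎
      where open ℚ.≤-Reasoning

lemma5p7 : (n : ℕ) (G : Graph n) (k : ℕ) (K : Fin k → List (Fin n)) →
    (∀ i → Unique (K i)) →
    (∀ i → AllPairs (Adj G) (K i)) →
    (∀ i → 3 ≤ length (K i)) →
    (∀ i j → i ≢ j → ∀ u v → u ≢ v →
      u ∈ K i → v ∈ K i → u ∈ K j → v ∈ K j → ⊥) →
    ∃[ I ] (All (IsTriangle G) I × AllPairs (λ t t' → ¬ ShareEdge t t') I ×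
      sumFin k (λ i → term (length (K i))) ≤ℚ ((+ length I) / 1))
lemma5p7 n G k K unique clique large apart =
  let 𝒫 , bound = family-packing G k K (λ i → term (length (K i))) apart
                    (λ i → clique-packing G (unique i) (clique i) (large i))
  in Packing.triangles 𝒫 , Packing.are-triangles 𝒫 , Packing.edge-disjoint 𝒫 , bound
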